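{- Let $G$ be a cubic graph that has a self-identifying code. Then every vertex of $G$ is adjacent to a triangle not containing itself if and only if every vertex of $G$ lies in a triangle.
   Context: All graphs are finite, simple, undirected and connected; a cubic graph is 3-regular. $N[v] = N(v) \cup \{v\}$; $N_S[v] = N[v] \cap S$. A set $S \subseteq V(G)$ is a self-identifying code (SIC) if for every $x \in V(G)$, $N_S[x] \neq \varnothing$ and $\bigcap_{v \in N_S[x]} N[v] = \{x\}$. A vertex $v$ is adjacent to a triangle not containing itself if there are vertices $a,b,c$ forming a triangle with $v \notin \{a,b,c\}$ and $va \in E(G)$. -}

module Defs where

open import Data.Nat using (ℕ; suc)
open import Data.Fin using (Fin)
open import Data.Fin.Subset using (Subset; _∈_)
open import Data.Bool using (Bool; true; false)
open import Data.List using (List; map)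
open import Data.Nat.ListAction using (sum)
open import Data.Fin using (toℕ)
open import Data.List using (allFin)
open import Data.Bool using (if_then_else_)
open import Data.Product using (Σ; ∃; _×_; _,_)
open import Data.Sum using (_⊎_)
open import Relation.Binary.PropositionalEquality using (_≡_; _≢_)
open import Relation.Nullary using (¬_)

record Graph (n : ℕ) : Set where
  field
    adj   : Fin n → Fin n → Bool
    sym   : ∀ u v → adj u v ≡ adj v u
    loopless : ∀ v → adj v v ≡ false

module _ {n : ℕ} (G : Graph n) where
  open Graph G

  Adj : Fin n → Fin n → Set
  Adj u v = adj u v ≡ true

  degree : Fin n → ℕ
  degree v = sum (map (λ u → if adj v u then 1 else 0) (allFin n))

  data Walk : Fin n → Fin n → Set where
    here : ∀ {v} → Walk v v
    step : ∀ {u w v} → Adj u w → Walk w v → Walk u v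

  Connected : Set
  Connected = ∀ u v → Walk u v

  Cubic : Set
  Cubic = ∀ v → degree v ≡ 3

  InN[_] : Fin n → Fin n → Set
  InN[ v ] x = x ≡ v ⊎ Adj v x

  -- S is a self-identifying code: for every x, N_S[x] = N[x] ∩ S is nonempty
  -- and the intersection of N[v] over v ∈ N_S[x] is exactly {x}
  -- (x always belongs to that intersection, so it suffices that it is ⊆ {x}).
  IsSIC : Subset n → Set
  IsSIC S = ∀ x →
    (∃ λ v → v ∈ S × InN[ x ] v)
    × (∀ y → (∀ v → v ∈ S → InN[ x ] v → InN[ v ] y) → y ≡ x)

  HasSIC : Set
  HasSIC = ∃ λ S → IsSIC S

  Triangle : Fin n → Fin n → Fin n → Set
  Triangle a b c = Adj a b × Adj b c × Adj a c

  InTriangle : Fin n → Set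
  InTriangle v = ∃ λ b → ∃ λ c → Triangle v b c

  AdjToTriangle : Fin n → Set
  AdjToTriangle v = ∃ λ a → ∃ λ b → ∃ λ c →
    Triangle a b c × v ≢ a × v ≢ b × v ≢ c × Adj v a

-- In a cubic graph with a self-identifying code no closed neighbourhood N[x]
-- lies inside another one N[a], since a would then belong to every N[v] with
-- v ∈ N_S[x]. Consequently no vertex has a neighbour adjacent to both of its
-- other neighbours; hence every vertex lies in at most one triangle, and a
-- vertex in a triangle has no common neighbour with its third neighbour.
-- If every vertex v is adjacent to a triangle through a vertex a(v), then a(v)
-- has v as its only neighbour outside its unique triangle, so v ↦ a(v) is an
-- injective, hence surjective, map on a finite set: every vertex is some a(v)
-- and so lies in a triangle. Conversely, if every vertex lies in a triangle,
-- the triangle of the third neighbour w of v avoids v, as v and w have no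
-- common neighbour.
module Submission where

open import Defs
open import Data.Bool using (Bool; true; false; if_then_else_)
open import Data.Empty using (⊥; ⊥-elim)
open import Data.Fin using (Fin; zero; suc; punchOut)
open import Data.Fin.Properties using (_≟_; any?; pigeonhole; punchOut-injective; <⇒≢)
open import Data.Fin.Subset using (Subset; _∈_; _-_; ⁅_⁆; ∣_∣; inside; outside) renaming (⊥ to ∅)
open import Data.Fin.Subset.Properties
  using (nonempty?; Empty-unique; ∣⊥∣≡0; p─⊥≡p; p─q─q≡p─q; p─q⊆p; x∈p⇒∣p-x∣<∣p∣; x∈p∧x≢y⇒x∈p-y)
open import Data.List as List using ()
open import Data.List.Properties using (map-tabulate)
open import Data.Nat using (ℕ; zero; suc; _+_; _≤_; _<_; z≤n; s≤s)
open import Data.Nat.ListAction using (sum)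
open import Data.Nat.Properties using (≤-refl; ≤-reflexive; ≤-<-trans; <-irrefl; n≤1+n; n<1+n; module ≤-Reasoning)
open import Data.Product using (∃; _×_; _,_; proj₁; proj₂)
open import Data.Sum using (_⊎_; inj₁; inj₂; [_,_]′)
open import Data.Vec as Vec using (_∷_)
open import Data.Vec.Properties using (lookup∘tabulate; []=⇒lookup; lookup⇒[]=)
open import Function using (_∘_; id)
open import Function.Bundles using (_⇔_; mk⇔)
open import Function.Definitions using (Injective)
open import Relation.Binary.PropositionalEquality using (_≡_; _≢_; refl; sym; trans; cong; subst; ≢-sym)
open import Relation.Nullary using (yes; no)

injective⇒surjective : ∀ {n} {f : Fin n → Fin n} → Injective _≡_ _≡_ f → ∀ y → ∃ λ x → f x ≡ y
injective⇒surjective {suc m} {f} f-injective y with any? (λ x → f x ≟ y)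
... | yes hit = hit
... | no miss =
  let i , j , i<j , collision = pigeonhole (n<1+n m) (λ x → punchOut (y≢f x))
  in ⊥-elim (<⇒≢ i<j (f-injective (punchOut-injective (y≢f i) (y≢f j) collision)))
  where
  y≢f : ∀ x → y ≢ f x
  y≢f x y≡fx = miss (x , sym y≡fx)

∣p∣≤1+∣p-x∣ : ∀ {n} (p : Subset n) x → ∣ p ∣ ≤ suc ∣ p - x ∣
∣p∣≤1+∣p-x∣ (inside  ∷ p) zero    = ≤-reflexive (cong (suc ∘ ∣_∣) (sym (p─⊥≡p p)))
∣p∣≤1+∣p-x∣ (outside ∷ p) zero    = subst (λ q → ∣ p ∣ ≤ suc ∣ q ∣) (sym (p─⊥≡p p)) (n≤1+n ∣ p ∣)
∣p∣≤1+∣p-x∣ (inside  ∷ p) (suc x) = s≤s (∣p∣≤1+∣p-x∣ p x)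
∣p∣≤1+∣p-x∣ (outside ∷ p) (suc x) = ∣p∣≤1+∣p-x∣ p x

module _ {n : ℕ} where

  -- Removing y twice changes nothing, whereas removing a member strictly shrinks.
  x∈p-y⇒x≢y : ∀ {p : Subset n} {x y} → x ∈ p - y → x ≢ y
  x∈p-y⇒x≢y {p} {y = y} x∈p-y refl =
    <-irrefl (cong ∣_∣ (p─q─q≡p─q p ⁅ y ⁆)) (x∈p⇒∣p-x∣<∣p∣ x∈p-y)

  4≤∣p∣ : ∀ {p : Subset n} {a b c d} → a ∈ p → b ∈ p → c ∈ p → d ∈ p →
          a ≢ b → a ≢ c → a ≢ d → b ≢ c → b ≢ d → c ≢ d → 4 ≤ ∣ p ∣
  4≤∣p∣ {p} {a} {b} {c} {d} a∈p b∈p c∈p d∈p a≢b a≢c a≢d b≢c b≢d c≢d =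
    grow a∈p (grow b∈p-a (grow c∈p-a-b (grow d∈p-a-b-c z≤n)))
    where
    grow : ∀ {q : Subset n} {x k} → x ∈ q → k ≤ ∣ q - x ∣ → suc k ≤ ∣ q ∣
    grow x∈q k≤∣q-x∣ = ≤-<-trans k≤∣q-x∣ (x∈p⇒∣p-x∣<∣p∣ x∈q)
    b∈p-a : b ∈ p - a
    b∈p-a = x∈p∧x≢y⇒x∈p-y b∈p (≢-sym a≢b)
    c∈p-a-b : c ∈ p - a - b
    c∈p-a-b = x∈p∧x≢y⇒x∈p-y (x∈p∧x≢y⇒x∈p-y c∈p (≢-sym a≢c)) (≢-sym b≢c)
    d∈p-a-b-c : d ∈ p - a - b - c
    d∈p-a-b-c =
      x∈p∧x≢y⇒x∈p-y (x∈p∧x≢y⇒x∈p-y (x∈p∧x≢y⇒x∈p-y d∈p (≢-sym a≢d)) (≢-sym b≢d)) (≢-sym c≢d)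

  ∃-∈-≢₂ : ∀ {p : Subset n} → 2 < ∣ p ∣ → ∀ b c → ∃ λ w → w ∈ p × w ≢ b × w ≢ c
  ∃-∈-≢₂ {p} 2<∣p∣ b c with nonempty? (p - b - c)
  ... | yes (w , w∈p-b-c) =
    let w∈p-b = p─q⊆p (p - b) ⁅ c ⁆ w∈p-b-c
    in w , p─q⊆p p ⁅ b ⁆ w∈p-b , x∈p-y⇒x≢y w∈p-b , x∈p-y⇒x≢y w∈p-b-c
  ... | no empty = ⊥-elim (<-irrefl refl (≤-<-trans ∣p∣≤2 2<∣p∣))
    where
    open ≤-Reasoning
    ∣p∣≤2 : ∣ p ∣ ≤ 2
    ∣p∣≤2 = begin
      ∣ p ∣                   ≤⟨ ∣p∣≤1+∣p-x∣ p b ⟩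
      suc ∣ p - b ∣           ≤⟨ s≤s (∣p∣≤1+∣p-x∣ (p - b) c) ⟩
      suc (suc ∣ p - b - c ∣) ≡⟨ cong (λ q → suc (suc ∣ q ∣)) (Empty-unique empty) ⟩
      suc (suc ∣ ∅ {n} ∣)     ≡⟨ cong (λ k → suc (suc k)) (∣⊥∣≡0 n) ⟩
      2                       ∎

∣b∷p∣≡ : ∀ {n} (b : Bool) (p : Subset n) → ∣ b ∷ p ∣ ≡ (if b then 1 else 0) + ∣ p ∣
∣b∷p∣≡ true  p = refl
∣b∷p∣≡ false p = refl

∣tabulate∣≡sum : ∀ {n} (f : Fin n → Bool) →
                 ∣ Vec.tabulate f ∣ ≡ sum (List.tabulate (λ u → if f u then 1 else 0))
∣tabulate∣≡sum {zero}  f = refl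
∣tabulate∣≡sum {suc n} f =
  trans (∣b∷p∣≡ (f zero) (Vec.tabulate (f ∘ suc)))
        (cong ((if f zero then 1 else 0) +_) (∣tabulate∣≡sum (f ∘ suc)))

module _ {n : ℕ} (G : Graph n) where
  open Graph G using (adj)

  adj-sym : ∀ {u v} → Adj G u v → Adj G v u
  adj-sym {u} {v} uv = trans (Graph.sym G v u) uv

  adj⇒≢ : ∀ {u v} → Adj G u v → u ≢ v
  adj⇒≢ {u} uv refl with trans (sym uv) (Graph.loopless G u)
  ... | ()

  InN-sym : ∀ {u v} → InN[_] G u v → InN[_] G v u
  InN-sym (inj₁ v≡u) = inj₁ (sym v≡u)
  InN-sym (inj₂ uv)  = inj₂ (adj-sym uv)

  N[_]⊆N[_] : Fin n → Fin n → Set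
  N[ x ]⊆N[ a ] = ∀ v → InN[_] G x v → InN[_] G a v

  SIC-N[x]⊆N[a]⇒a≡x : HasSIC G → ∀ {x a} → N[ x ]⊆N[ a ] → a ≡ x
  SIC-N[x]⊆N[a]⇒a≡x (_ , sic) {x} {a} N[x]⊆N[a] =
    proj₂ (sic x) a (λ v _ v∈N[x] → InN-sym (N[x]⊆N[a] v v∈N[x]))

  N : Fin n → Subset n
  N v = Vec.tabulate (adj v)

  Adj⇒∈N : ∀ {v u} → Adj G v u → u ∈ N v
  Adj⇒∈N {v} {u} vu = lookup⇒[]= u (N v) (trans (lookup∘tabulate (adj v) u) vu)

  ∈N⇒Adj : ∀ {v u} → u ∈ N v → Adj G v u
  ∈N⇒Adj {v} {u} u∈N = trans (sym (lookup∘tabulate (adj v) u)) ([]=⇒lookup u∈N)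

  degree≡∣N∣ : ∀ v → degree G v ≡ ∣ N v ∣
  degree≡∣N∣ v = trans (cong sum (map-tabulate id (λ u → if adj v u then 1 else 0)))
                       (sym (∣tabulate∣≡sum (adj v)))

  module _ (cubic : Cubic G) where

    ∣N∣≡3 : ∀ v → ∣ N v ∣ ≡ 3
    ∣N∣≡3 v = trans (sym (degree≡∣N∣ v)) (cubic v)

    neighbour-is-one-of : ∀ {v a b c x} → Adj G v a → Adj G v b → Adj G v c →
                          a ≢ b → a ≢ c → b ≢ c → Adj G v x → x ≡ a ⊎ x ≡ b ⊎ x ≡ c
    neighbour-is-one-of {v} {a} {b} {c} {x} va vb vc a≢b a≢c b≢c vx
      with x ≟ a | x ≟ b | x ≟ c
    ... | yes x≡a | _       | _       = inj₁ x≡a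
    ... | no _    | yes x≡b | _       = inj₂ (inj₁ x≡b)
    ... | no _    | no _    | yes x≡c = inj₂ (inj₂ x≡c)
    ... | no x≢a  | no x≢b  | no x≢c  =
      ⊥-elim (<-irrefl refl (subst (4 ≤_) (∣N∣≡3 v)
        (4≤∣p∣ (Adj⇒∈N va) (Adj⇒∈N vb) (Adj⇒∈N vc) (Adj⇒∈N vx)
               a≢b a≢c (≢-sym x≢a) b≢c (≢-sym x≢b) (≢-sym x≢c))))

    other-neighbour : ∀ v b c → ∃ λ w → Adj G v w × w ≢ b × w ≢ c
    other-neighbour v b c =
      let w , w∈N , w≢b , w≢c = ∃-∈-≢₂ (subst (2 <_) (sym (∣N∣≡3 v)) ≤-refl) b c
      in w , ∈N⇒Adj w∈N , w≢b , w≢c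

    module _ (sic : HasSIC G) where

      no-diamond : ∀ {x a b c} → Adj G x a → Adj G x b → Adj G x c →
                   Adj G a b → Adj G a c → b ≢ c → ⊥
      no-diamond {x} {a} xa xb xc ab ac b≢c = adj⇒≢ xa (sym (SIC-N[x]⊆N[a]⇒a≡x sic N[x]⊆N[a]))
        where
        N[x]⊆N[a] : N[ x ]⊆N[ a ]
        N[x]⊆N[a] _ (inj₁ refl) = inj₂ (adj-sym xa)
        N[x]⊆N[a] _ (inj₂ xv) with neighbour-is-one-of xa xb xc (adj⇒≢ ab) (adj⇒≢ ac) b≢c xv
        ... | inj₁ refl        = inj₁ refl
        ... | inj₂ (inj₁ refl) = inj₂ ab
        ... | inj₂ (inj₂ refl) = inj₂ ac

      triangle-unique : ∀ {a b c p q} → Triangle G a b c → Triangle G a p q → b ≡ p ⊎ b ≡ q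
      triangle-unique {a} {b} {c} (ab , bc , ac) (ap , pq , aq)
        with other-neighbour a b c
      ... | w , aw , w≢b , w≢c
        with one-of ap | one-of aq
        where
        one-of : ∀ {x} → Adj G a x → x ≡ b ⊎ x ≡ c ⊎ x ≡ w
        one-of = neighbour-is-one-of ab ac aw (adj⇒≢ bc) (≢-sym w≢b) (≢-sym w≢c)
      ... | inj₁ refl        | _                = inj₁ refl
      ... | _                | inj₁ refl        = inj₂ refl
      ... | inj₂ (inj₁ refl) | inj₂ (inj₁ refl) = ⊥-elim (adj⇒≢ pq refl)
      ... | inj₂ (inj₂ refl) | inj₂ (inj₂ refl) = ⊥-elim (adj⇒≢ pq refl)
      ... | inj₂ (inj₁ refl) | inj₂ (inj₂ refl) = ⊥-elim (no-diamond ac ab aw (adj-sym bc) pq (≢-sym w≢b))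
      ... | inj₂ (inj₂ refl) | inj₂ (inj₁ refl) = ⊥-elim (no-diamond ac ab aw (adj-sym bc) (adj-sym pq) (≢-sym w≢b))

      no-common-neighbour : ∀ {v b c w p} → Triangle G v b c → Adj G v w → w ≢ b → w ≢ c →
                            Adj G v p → Adj G w p → ⊥
      no-common-neighbour (vb , bc , vc) vw w≢b w≢c vp wp
        with triangle-unique (vb , bc , vc) (vw , wp , vp)
           | triangle-unique (vc , adj-sym bc , vb) (vw , wp , vp)
      ... | inj₁ b≡w | _        = w≢b (sym b≡w)
      ... | _        | inj₁ c≡w = w≢c (sym c≡w)
      ... | inj₂ b≡p | inj₂ c≡p = adj⇒≢ bc (trans b≡p (sym c≡p))

      InTriangle⇒AdjToTriangle : (∀ v → InTriangle G v) → ∀ v → AdjToTriangle G v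
      InTriangle⇒AdjToTriangle inTriangle v with inTriangle v
      ... | b , c , vbc@(vb , _ , vc) with other-neighbour v b c
      ... | w , vw , w≢b , w≢c with inTriangle w
      ... | p , q , wpq@(wp , pq , wq) =
        w , p , q , wpq , adj⇒≢ vw
          , (λ { refl → no-common-neighbour vbc vw w≢b w≢c pq wq })
          , (λ { refl → no-common-neighbour vbc vw w≢b w≢c (adj-sym pq) wp })
          , vw

      module _ (adjToTriangle : ∀ v → AdjToTriangle G v) where

        attachment : Fin n → Fin n
        attachment v = proj₁ (adjToTriangle v)

        attachment-injective : Injective _≡_ _≡_ attachment
        attachment-injective {u} {v} same with adjToTriangle u | adjToTriangle v | same
        ... | a , b , c , (ab , bc , ac) , _ , u≢b , u≢c , ua
            | .a , _ , _ , abc′ , _ , v≢b′ , v≢c′ , va | refl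
          with neighbour-is-one-of ab ac (adj-sym ua) (adj⇒≢ bc) (≢-sym u≢b) (≢-sym u≢c) (adj-sym va)
        ... | inj₁ refl        = ⊥-elim ([ v≢b′ , v≢c′ ]′ (triangle-unique (ab , bc , ac) abc′))
        ... | inj₂ (inj₁ refl) = ⊥-elim ([ v≢b′ , v≢c′ ]′ (triangle-unique (ac , adj-sym bc , ab) abc′))
        ... | inj₂ (inj₂ v≡u)  = sym v≡u

        AdjToTriangle⇒InTriangle : ∀ v → InTriangle G v
        AdjToTriangle⇒InTriangle v with injective⇒surjective attachment-injective v
        ... | u , refl = let _ , b , c , abc , _ = adjToTriangle u in b , c , abc

mainTheorem11 : ∀ (n : ℕ) (G : Graph n) → Connected G → Cubic G → HasSIC G →
    ((∀ v → AdjToTriangle G v) ⇔ (∀ v → InTriangle G v))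
mainTheorem11 n G _ cubic sic =
  mk⇔ (AdjToTriangle⇒InTriangle G cubic sic) (InTriangle⇒AdjToTriangle G cubic sic)
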